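{- Let $\{b_s\}_{s\in\omega^{<\omega}}$, $C_s$, $h_0$, $K_0$ and $f_0:K_0\to\mathbb{Z}^\omega$ be as defined in the context. If $X\subseteq\mathbb{Z}^\omega$ satisfies that the set $\{s'\in\omega^{<\omega} : X\cap C_{s'}=\emptyset\}$ is cofinal in $\omega^{<\omega}$, then $f_0^{ -1}(X)$ is nowhere dense in $K_0$.
   Context: $\mathbb{Z}^\omega$ has the product topology of discrete copies of $\mathbb{Z}$; $\{0,1\}^\omega\subseteq\mathbb{Z}^\omega$. For finite sequences, $|s|$ is the length, $s^\frown s'$ is concatenation, $s\subseteq s'$ means $s$ is an initial segment of $s'$, and $\emptyset$ is the empty sequence. A set $A\subseteq\omega^{<\omega}$ is cofinal if for every $s\in\omega^{<\omega}$ there is $a\in A$ with $s\subseteq a$. For $m\in\mathbb{N}$, an infinite sequence $x$ is $m$-segmented if $x_{q2^m+r_1}=x_{q2^m+r_2}$ for all $q\in\mathbb{N}$ and $0\le r_1,r_2<2^m$; a finite sequence $\beta$ is $m$-segmented if $|\beta|=Q\cdot2^m$ for some $Q\in\mathbb{N}$ and $\beta_{q2^m+r_1}=\beta_{q2^m+r_2}$ for all $0\le q<Q$, $0\le r_1,r_2<2^m$. Fix sequences $b_s\in\{0,1\}^{<\omega}$ for $s\in\omega^{<\omega}$ such that: (1) $b_\emptyset=\emptyset$; (2) $|b_s|$ is divisible by $2^{|s|}$; (3) if $s\in\omega^{<\omega}$ and $\beta$ is a nonempty finite $|s|$-segmented sequence with $|b_s|+|\beta|$ divisible by $2^{|s|+1}$,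 then there is exactly one $\ell\in\omega$ with $b_{s^\frown\ell}=b_s^\frown\beta$; (4) conversely, for every $s\in\omega^{<\omega}$ and $\ell\in\omega$, $b_{s^\frown\ell}=b_s^\frown\beta$ for some nonempty finite $|s|$-segmented $\beta$ with $|b_s|+|\beta|$ divisible by $2^{|s|+1}$. Let $C_s=\{b_s^\frown x : x\in\{0,1\}^\omega \text{ is } |s|\text{ -segmented}\}\subseteq\mathbb{Z}^\omega$. For $n\in\omega$ let $h(n)\in\{0,1\}^{n+1}$ be $n$ zeros followed by a single $1$; for $s=(s_0,\dots,s_{k-1})\in\omega^{<\omega}$ let $h(s)=h(s_0)^\frown\cdots^\frown h(s_{k-1})$, and let $h_0(s)\in\{0,1\}^\omega$ be $h(s)$ followed by infinitely many zeros. Let $K_0$ be the closure of $\bigcup_{s\in\omega^{<\omega}}C_s\times\{h_0(s)\}$ in $\mathbb{Z}^\omega\times\{0,1\}^\omega$, and let $f_0:K_0\to\mathbb{Z}^\omega$ be the restriction of the projection onto the first coordinate. -}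

module Defs where

open import Data.Nat using (ℕ; zero; suc; _+_; _*_; _^_; _<_)
open import Data.Nat.Divisibility using (_∣_)
open import Data.Integer using (ℤ; 0ℤ; 1ℤ)
open import Data.Bool using (Bool; true; false)
open import Data.List using (List; []; _∷_; _++_; [_]; length; replicate; concatMap)
open import Data.Maybe using (Maybe; just; nothing)
open import Data.Product using (Σ; _×_; _,_; ∃; proj₁)
open import Relation.Binary.PropositionalEquality using (_≡_; _≢_)
open import Relation.Nullary using (¬_)

_⊑_ : List ℕ → List ℕ → Set
s ⊑ a = Σ (List ℕ) λ t → a ≡ s ++ t

Cofinal : (List ℕ → Set) → Set
Cofinal A = ∀ s → Σ (List ℕ) λ a → (s ⊑ a) × A a

at : {A : Set} → List A → ℕ → Maybe A
at []       _       = nothing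
at (x ∷ xs) zero    = just x
at (x ∷ xs) (suc n) = at xs n

_⁀_ : {A : Set} → List A → (ℕ → A) → (ℕ → A)
([]     ⁀ x) n       = x n
((a ∷ l) ⁀ x) zero    = a
((a ∷ l) ⁀ x) (suc n) = (l ⁀ x) n

b2z : Bool → ℤ
b2z false = 0ℤ
b2z true  = 1ℤ

SegInf : ℕ → (ℕ → Bool) → Set
SegInf m x = ∀ q r₁ r₂ → r₁ < 2 ^ m → r₂ < 2 ^ m →
  x (q * 2 ^ m + r₁) ≡ x (q * 2 ^ m + r₂)

SegFin : ℕ → List Bool → Set
SegFin m β = Σ ℕ λ Q → (length β ≡ Q * 2 ^ m) ×
  (∀ q r₁ r₂ → q < Q → r₁ < 2 ^ m → r₂ < 2 ^ m →
     at β (q * 2 ^ m + r₁) ≡ at β (q * 2 ^ m + r₂))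

record IsBFamily (b : List ℕ → List Bool) : Set where
  field
    cond1 : b [] ≡ []
    cond2 : ∀ s → 2 ^ length s ∣ length (b s)
    cond3 : ∀ s (β : List Bool) → β ≢ [] → SegFin (length s) β →
              2 ^ suc (length s) ∣ length (b s) + length β →
              Σ ℕ λ ℓ → (b (s ++ [ ℓ ]) ≡ b s ++ β) ×
                (∀ ℓ' → b (s ++ [ ℓ' ]) ≡ b s ++ β → ℓ' ≡ ℓ)
    cond4 : ∀ s (ℓ : ℕ) → Σ (List Bool) λ β → (β ≢ []) × SegFin (length s) β ×
              (2 ^ suc (length s) ∣ length (b s) + length β) ×
              (b (s ++ [ ℓ ]) ≡ b s ++ β)

C : (List ℕ → List Bool) → List ℕ → (ℕ → ℤ) → Set
C b s z = Σ (ℕ → Bool) λ x → SegInf (length s) x × (∀ n → z n ≡ b2z ((b s ⁀ x) n))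

hN : ℕ → List Bool
hN n = replicate n false ++ [ true ]

h : List ℕ → List Bool
h s = concatMap hN s

h₀ : List ℕ → ℕ → Bool
h₀ s = h s ⁀ (λ _ → false)

Point : Set
Point = (ℕ → ℤ) × (ℕ → Bool)

-- p and q agree on the first n coordinates (basic open neighbourhoods)
Agree : ℕ → Point → Point → Set
Agree n (z , y) (z' , y') = ∀ i → i < n → (z i ≡ z' i) × (y i ≡ y' i)

Closure : (Point → Set) → Point → Set
Closure S p = ∀ n → Σ Point λ q → S q × Agree n p q

K₀base : (List ℕ → List Bool) → Point → Set
K₀base b (z , y) = Σ (List ℕ) λ s → C b s z × (∀ n → y n ≡ h₀ s n)

K₀ : (List ℕ → List Bool) → Point → Set
K₀ b = Closure (K₀base b)

f₀⁻¹ : (List ℕ → List Bool) → ((ℕ → ℤ) → Set) → Point → Set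
f₀⁻¹ b X p = K₀ b p × X (proj₁ p)

InteriorIn : (Point → Set) → (Point → Set) → Point → Set
InteriorIn K B p = K p × Σ ℕ λ n → ∀ q → K q → Agree n p q → B q

ClosureIn : (Point → Set) → (Point → Set) → Point → Set
ClosureIn K A p = K p × Closure A p

NowhereDenseIn : (Point → Set) → (Point → Set) → Set
NowhereDenseIn K A = ∀ p → ¬ InteriorIn K (ClosureIn K A) p

module Submission where

-- Suppose some point p of K₀ has an n-neighbourhood inside cl(f₀⁻¹ X).  Since p lies
-- in the closure of ⋃ C_s × {h₀ s}, it is n-close to a point (b_s⁀x, h₀ s) with x an
-- |s|-segmented sequence.  Condition (3) supplies infinitely many children s⁀ℓ with
-- b_{s⁀ℓ} = b_s⁀(a long prefix of x), so we may take ℓ ≥ n; cofinality then gives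
-- a ⊒ s⁀ℓ with C_a ∩ X = ∅.  The canonical point q = (b_a⁀000…, h₀ a) lies in K₀ and
-- is n-close to p, hence q ∈ cl(f₀⁻¹ X), so some r ∈ K₀ with first coordinate in X
-- begins with h(a) in its second coordinate.  But every point of K₀ whose second
-- coordinate begins with h(a) has first coordinate in C_a, because h(a) ⊑ h(s'')
-- forces a ⊑ s'', C_{s''} ⊆ C_a, and C_a is closed.  Contradiction.

open import Defs
open import Data.Nat
open import Data.Nat.Properties
open import Data.Nat.DivMod using (_%_; _/_; m≡m%n+[m/n]*n; m%n<n)
open import Data.Nat.Divisibility using (_∣_; divides)
open import Data.Nat.Tactic.RingSolver using (solve-∀)
open import Data.Integer using (ℤ; +_)
open import Data.Bool using (Bool; true; false)
open import Data.List using (List; []; _∷_; _++_; [_]; length; applyUpTo; concat; map)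
open import Data.List.Properties using (length-++; ++-assoc; ++-identityʳ; length-applyUpTo; map-++; concat-++; ++-cancelˡ)
open import Data.Maybe using (just)
open import Data.Product using (Σ; ∃; ∃₂; _×_; _,_; proj₁; proj₂)
open import Data.Sum using (_⊎_; inj₁; inj₂)
open import Data.Fin using (toℕ; fromℕ<)
import Data.Fin.Properties as Fin
open import Function.Definitions using (Injective)
open import Relation.Binary.PropositionalEquality hiding ([_])
open import Relation.Nullary using (¬_; yes; no; contradiction)

_≈[_]_ : {A : Set} → (ℕ → A) → ℕ → (ℕ → A) → Set
x ≈[ k ] y = ∀ i → i < k → x i ≡ y i

≈-weaken : {A : Set} {x y : ℕ → A} {k k' : ℕ} → k ≤ k' → x ≈[ k' ] y → x ≈[ k ] y
≈-weaken k≤k' x≈y i i<k = x≈y i (<-≤-trans i<k k≤k')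

⁀-beyond : {A : Set} (l : List A) (x : ℕ → A) (j : ℕ) → (l ⁀ x) (length l + j) ≡ x j
⁀-beyond []      x j = refl
⁀-beyond (a ∷ l) x j = ⁀-beyond l x j

⁀-++ : {A : Set} (l l' : List A) (x : ℕ → A) (i : ℕ) → ((l ++ l') ⁀ x) i ≡ (l ⁀ (l' ⁀ x)) i
⁀-++ []      l' x i       = refl
⁀-++ (a ∷ l) l' x zero    = refl
⁀-++ (a ∷ l) l' x (suc i) = ⁀-++ l l' x i

inside-or-beyond : (L i : ℕ) → i < L ⊎ ∃ λ j → i ≡ L + j
inside-or-beyond L i with i <? L
... | yes i<L = inj₁ i<L
... | no  i≮L with m≤n⇒∃[o]m+o≡n (≮⇒≥ i≮L)
...   | j , L+j≡i = inj₂ (j , sym L+j≡i)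

⁀-≈ : {A : Set} (l : List A) {x y : ℕ → A} {k : ℕ} → x ≈[ k ] y → (l ⁀ x) ≈[ length l + k ] (l ⁀ y)
⁀-≈ []      x≈y i       i<k           = x≈y i i<k
⁀-≈ (a ∷ l) x≈y zero    _             = refl
⁀-≈ (a ∷ l) x≈y (suc i) (s≤s i<l+k) = ⁀-≈ l x≈y i i<l+k

⁀-≈⁻¹ : {A : Set} (l : List A) {x y : ℕ → A} {k : ℕ} → (l ⁀ x) ≈[ length l + k ] (l ⁀ y) → x ≈[ k ] y
⁀-≈⁻¹ l {x} {y} agree j j<k = begin
  x j                    ≡⟨ ⁀-beyond l x j ⟨
  (l ⁀ x) (length l + j) ≡⟨ agree (length l + j) (+-monoʳ-< (length l) j<k) ⟩
  (l ⁀ y) (length l + j) ≡⟨ ⁀-beyond l y j ⟩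
  y j                    ∎
  where open ≡-Reasoning

at-⁀ : {A : Set} (l : List A) (x : ℕ → A) (i : ℕ) → i < length l → at l i ≡ just ((l ⁀ x) i)
at-⁀ (a ∷ l) x zero    _         = refl
at-⁀ (a ∷ l) x (suc i) (s≤s i<l) = at-⁀ l x i i<l

applyUpTo-⁀ : {A : Set} (f : ℕ → A) (L : ℕ) (y : ℕ → A) → (applyUpTo f L ⁀ y) ≈[ L ] f
applyUpTo-⁀ f (suc L) y zero    _         = refl
applyUpTo-⁀ f (suc L) y (suc i) (s≤s i<L) = applyUpTo-⁀ (λ j → f (suc j)) L y i i<L

at-applyUpTo : {A : Set} (f : ℕ → A) (L i : ℕ) → i < L → at (applyUpTo f L) i ≡ just (f i)
at-applyUpTo f (suc L) zero    _         = refl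
at-applyUpTo f (suc L) (suc i) (s≤s i<L) = at-applyUpTo (λ j → f (suc j)) L i i<L

applyUpTo-nonempty : {A : Set} (f : ℕ → A) (L : ℕ) .{{_ : NonZero L}} → applyUpTo f L ≢ []
applyUpTo-nonempty f (suc L) ()

block-bound : ∀ {q Q r} P → q < Q → r < P → q * P + r < Q * P
block-bound {q} {Q} {r} P q<Q r<P = begin-strict
  q * P + r <⟨ +-monoʳ-< (q * P) r<P ⟩
  q * P + P ≡⟨ +-comm (q * P) P ⟩
  suc q * P ≤⟨ *-monoˡ-≤ P q<Q ⟩
  Q * P     ∎
  where open ≤-Reasoning

in-double : ∀ {e r} P → e < 2 → r < P → e * P + r < 2 * P
in-double {e} {r} P e<2 r<P = begin-strict
  e * P + r <⟨ +-monoʳ-< (e * P) r<P ⟩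
  e * P + P ≤⟨ +-monoˡ-≤ P (*-monoˡ-≤ P (s≤s⁻¹ e<2)) ⟩
  1 * P + P ≡⟨ +-comm (1 * P) P ⟩
  2 * P     ∎
  where open ≤-Reasoning

-- Each 2^(m+1)-block consists of two 2^m-blocks, so (m+1)-segmented implies m-segmented.
segmented-coarsen : ∀ m x → SegInf (suc m) x → SegInf m x
segmented-coarsen m x seg q r₁ r₂ r₁<P r₂<P = begin
  x (q * P + r₁)                        ≡⟨ cong x (regroup r₁) ⟩
  x (q / 2 * (2 * P) + (q % 2 * P + r₁)) ≡⟨ seg (q / 2) _ _ (in-double P q%2<2 r₁<P) (in-double P q%2<2 r₂<P) ⟩
  x (q / 2 * (2 * P) + (q % 2 * P + r₂)) ≡⟨ cong x (regroup r₂) ⟨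
  x (q * P + r₂)                        ∎
  where
    open ≡-Reasoning
    P = 2 ^ m
    regroup-ring : ∀ e d P r → (e + d * 2) * P + r ≡ d * (2 * P) + (e * P + r)
    regroup-ring = solve-∀
    regroup : ∀ r → q * P + r ≡ q / 2 * (2 * P) + (q % 2 * P + r)
    regroup r = trans (cong (λ v → v * P + r) (m≡m%n+[m/n]*n q 2)) (regroup-ring (q % 2) (q / 2) P r)
    q%2<2 : q % 2 < 2
    q%2<2 = m%n<n q 2

segmented-prefix : ∀ m x Q → SegInf m x → SegFin m (applyUpTo x (Q * 2 ^ m))
segmented-prefix m x Q seg = Q , length-applyUpTo x (Q * 2 ^ m) , same-block
  where
    open ≡-Reasoning
    P = 2 ^ m
    same-block : ∀ q r₁ r₂ → q < Q → r₁ < P → r₂ < P →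
                 at (applyUpTo x (Q * P)) (q * P + r₁) ≡ at (applyUpTo x (Q * P)) (q * P + r₂)
    same-block q r₁ r₂ q<Q r₁<P r₂<P = begin
      at (applyUpTo x (Q * P)) (q * P + r₁) ≡⟨ at-applyUpTo x _ _ (block-bound P q<Q r₁<P) ⟩
      just (x (q * P + r₁))                 ≡⟨ cong just (seg q r₁ r₂ r₁<P r₂<P) ⟩
      just (x (q * P + r₂))                 ≡⟨ at-applyUpTo x _ _ (block-bound P q<Q r₂<P) ⟨
      at (applyUpTo x (Q * P)) (q * P + r₂) ∎

segmented-⁀ : ∀ m β x → SegFin m β → SegInf m x → SegInf m (β ⁀ x)
segmented-⁀ m β x (Q , |β|≡ , segβ) segx q r₁ r₂ r₁<P r₂<P with q <? Q
... | yes q<Q = just-injective (begin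
  just ((β ⁀ x) (q * P + r₁)) ≡⟨ at-⁀ β x _ (inside r₁<P) ⟨
  at β (q * P + r₁)           ≡⟨ segβ q r₁ r₂ q<Q r₁<P r₂<P ⟩
  at β (q * P + r₂)           ≡⟨ at-⁀ β x _ (inside r₂<P) ⟩
  just ((β ⁀ x) (q * P + r₂)) ∎)
  where
    open ≡-Reasoning
    P = 2 ^ m
    just-injective : {a a' : Bool} → just a ≡ just a' → a ≡ a'
    just-injective refl = refl
    inside : ∀ {r} → r < P → q * P + r < length β
    inside {r} r<P = subst (q * P + r <_) (sym |β|≡) (block-bound P q<Q r<P)
... | no q≮Q with m≤n⇒∃[o]m+o≡n (≮⇒≥ q≮Q)
...   | d , refl = begin
  (β ⁀ x) ((Q + d) * P + r₁)        ≡⟨ cong (β ⁀ x) (beyond r₁) ⟩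
  (β ⁀ x) (length β + (d * P + r₁)) ≡⟨ ⁀-beyond β x _ ⟩
  x (d * P + r₁)                    ≡⟨ segx d r₁ r₂ r₁<P r₂<P ⟩
  x (d * P + r₂)                    ≡⟨ ⁀-beyond β x _ ⟨
  (β ⁀ x) (length β + (d * P + r₂)) ≡⟨ cong (β ⁀ x) (beyond r₂) ⟨
  (β ⁀ x) ((Q + d) * P + r₂)        ∎
  where
    open ≡-Reasoning
    P = 2 ^ m
    shift : ∀ Q d P r → (Q + d) * P + r ≡ Q * P + (d * P + r)
    shift = solve-∀
    beyond : ∀ r → (Q + d) * P + r ≡ length β + (d * P + r)
    beyond r = trans (shift Q d P r) (cong (_+ (d * P + r)) (sym |β|≡))

-- The cone over a word w: all w⁀x with x m-segmented.  C b s is Cone (b s) |s|.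
Cone : List Bool → ℕ → (ℕ → ℤ) → Set
Cone w m z = Σ (ℕ → Bool) λ x → SegInf m x × (∀ n → z n ≡ b2z ((w ⁀ x) n))

isOne : ℤ → Bool
isOne (+ suc zero) = true
isOne _            = false

isOne-b2z : ∀ c → isOne (b2z c) ≡ c
isOne-b2z true  = refl
isOne-b2z false = refl

-- Cones are closed in ℤ^ω: the continuation of a limit is read off digit by digit.
Cone-closed : ∀ w m z → (∀ M → ∃ λ z' → Cone w m z' × z ≈[ M ] z') → Cone w m z
Cone-closed w m z approx = x , segmented , decodes
  where
    open ≡-Reasoning
    x : ℕ → Bool
    x j = isOne (z (length w + j))
    digit : ∀ {z'} (c : Cone w m z') j → z (length w + j) ≡ z' (length w + j) → proj₁ c j ≡ x j
    digit {z'} (x' , _ , z'≡) j zj≡ = begin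
      x' j                                 ≡⟨ isOne-b2z (x' j) ⟨
      isOne (b2z (x' j))                   ≡⟨ cong (λ c → isOne (b2z c)) (⁀-beyond w x' j) ⟨
      isOne (b2z ((w ⁀ x') (length w + j))) ≡⟨ cong isOne (trans zj≡ (z'≡ _)) ⟨
      x j                                  ∎
    decodes : ∀ i → z i ≡ b2z ((w ⁀ x) i)
    decodes i with approx (suc i) | inside-or-beyond (length w) i
    ... | z' , (x' , _ , z'≡) , z≈z' | inj₁ i<|w| =
      trans (z≈z' i ≤-refl) (trans (z'≡ i) (cong b2z (⁀-≈ w {k = 0} (λ _ ()) i (<-≤-trans i<|w| (m≤m+n (length w) 0)))))
    ... | z' , c@(x' , _ , z'≡) , z≈z' | inj₂ (j , refl) = begin
      z (length w + j)            ≡⟨ z≈z' _ ≤-refl ⟩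
      z' (length w + j)           ≡⟨ z'≡ _ ⟩
      b2z ((w ⁀ x') (length w + j)) ≡⟨ cong b2z (⁀-beyond w x' j) ⟩
      b2z (x' j)                  ≡⟨ cong b2z (digit c j (z≈z' _ ≤-refl)) ⟩
      b2z (x j)                   ≡⟨ cong b2z (⁀-beyond w x j) ⟨
      b2z ((w ⁀ x) (length w + j)) ∎
    segmented : SegInf m x
    segmented q r₁ r₂ r₁<P r₂<P with approx (suc (length w + ((q * 2 ^ m + r₁) + (q * 2 ^ m + r₂))))
    ... | z' , c@(x' , seg' , _) , z≈z' = begin
      x (q * 2 ^ m + r₁)  ≡⟨ digit c _ (z≈z' _ (s≤s (+-monoʳ-≤ (length w) (m≤m+n _ _)))) ⟨
      x' (q * 2 ^ m + r₁) ≡⟨ seg' q r₁ r₂ r₁<P r₂<P ⟩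
      x' (q * 2 ^ m + r₂) ≡⟨ digit c _ (z≈z' _ (s≤s (+-monoʳ-≤ (length w) (m≤n+m _ (q * 2 ^ m + r₁))))) ⟩
      x (q * 2 ^ m + r₂)  ∎

length-hN : ∀ a → length (hN a) ≡ suc a
length-hN zero    = refl
length-hN (suc a) = cong suc (length-hN a)

h₀-cons : ∀ a t i → h₀ (a ∷ t) i ≡ (hN a ⁀ h₀ t) i
h₀-cons a t i = ⁀-++ (hN a) (h t) _ i

h-++ : ∀ s u → h (s ++ u) ≡ h s ++ h u
h-++ s u = trans (cong concat (map-++ hN s u)) (sym (concat-++ (map hN s) (map hN u)))

hN-zeros : ∀ a y → (hN a ⁀ y) ≈[ a ] (λ _ → false)
hN-zeros (suc a) y zero    _         = refl
hN-zeros (suc a) y (suc j) (s≤s j<a) = hN-zeros a y j j<a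

hN-one : ∀ a y → (hN a ⁀ y) a ≡ true
hN-one zero    y = refl
hN-one (suc a) y = hN-one a y

hN-determined : ∀ a c {y y'} → (hN a ⁀ y) ≈[ suc a ] (hN c ⁀ y') → a ≡ c
hN-determined zero    zero    agree = refl
hN-determined zero    (suc c) agree with agree 0 z<s
... | ()
hN-determined (suc a) zero    agree with agree 0 z<s
... | ()
hN-determined (suc a) (suc c) agree = cong suc (hN-determined a c (λ i i<a → agree (suc i) (s≤s i<a)))

h₀-prefix : ∀ s s' → h₀ s ≈[ length (h s) ] h₀ s' → s ⊑ s'
h₀-prefix []      s' _     = s' , refl
h₀-prefix (a ∷ t) s' agree = from-blocks s' blocks-agree
  where
    first-block : suc a ≤ length (hN a) + length (h t)
    first-block = subst (_≤ length (hN a) + length (h t)) (length-hN a) (m≤m+n _ _)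
    blocks-agree : (hN a ⁀ h₀ t) ≈[ length (hN a) + length (h t) ] h₀ s'
    blocks-agree i i<|h| = trans (sym (h₀-cons a t i)) (agree i (subst (i <_) (sym (length-++ (hN a))) i<|h|))
    from-blocks : ∀ s' → (hN a ⁀ h₀ t) ≈[ length (hN a) + length (h t) ] h₀ s' → (a ∷ t) ⊑ s'
    from-blocks []      agree' with trans (sym (hN-one a (h₀ t))) (agree' a first-block)
    ... | ()
    from-blocks (c ∷ u) agree' with hN-determined a c (≈-weaken first-block (λ i i<n → trans (agree' i i<n) (h₀-cons c u i)))
    ... | refl with h₀-prefix t u (⁀-≈⁻¹ (hN a) (λ i i<n → trans (agree' i i<n) (h₀-cons a u i)))
    ...   | t' , u≡ = t' , cong (a ∷_) u≡

-- h₀ s and h₀ (s⁀ℓ⁀t) share their first |h s| + ℓ terms, since h(ℓ) begins with ℓ zeros.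
h₀-extension : ∀ s ℓ t → h₀ s ≈[ length (h s) + ℓ ] h₀ (s ++ ℓ ∷ t)
h₀-extension s ℓ t i i<n = begin
  h₀ s i                              ≡⟨ ⁀-≈ (h s) zeros i i<n ⟩
  (h s ⁀ h₀ (ℓ ∷ t)) i                ≡⟨ ⁀-++ (h s) (h (ℓ ∷ t)) _ i ⟨
  ((h s ++ h (ℓ ∷ t)) ⁀ (λ _ → false)) i ≡⟨ cong (λ w → (w ⁀ (λ _ → false)) i) (h-++ s (ℓ ∷ t)) ⟨
  h₀ (s ++ ℓ ∷ t) i                   ∎
  where
    open ≡-Reasoning
    zeros : (λ _ → false) ≈[ ℓ ] h₀ (ℓ ∷ t)
    zeros j j<ℓ = sym (trans (h₀-cons ℓ t j) (hN-zeros ℓ (h₀ t) j j<ℓ))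

Agree-trans : ∀ {n} {p q r : Point} → Agree n p q → Agree n q r → Agree n p r
Agree-trans p≈q q≈r i i<n = trans (proj₁ (p≈q i i<n)) (proj₁ (q≈r i i<n))
                          , trans (proj₂ (p≈q i i<n)) (proj₂ (q≈r i i<n))

canonical : (List ℕ → List Bool) → List ℕ → Point
canonical b a = (λ i → b2z ((b a ⁀ (λ _ → false)) i)) , h₀ a

canonical∈K₀ : ∀ b a → K₀ b (canonical b a)
canonical∈K₀ b a _ = canonical b a , (a , zeros∈C , λ _ → refl) , λ _ _ → refl , refl
  where
    zeros∈C : C b a (proj₁ (canonical b a))
    zeros∈C = (λ _ → false) , (λ _ _ _ _ _ → refl) , λ _ → refl

-- An injective map ℕ → ℕ takes arbitrarily large values (pigeonhole on 0, …, n).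
injective⇒unbounded : (g : ℕ → ℕ) → Injective _≡_ _≡_ g → ∀ n → ∃ λ k → n ≤ g k
injective⇒unbounded g g-inj n with Fin.any? {n = suc n} (λ k → n ≤? g (toℕ k))
... | yes (k , n≤gk) = toℕ k , n≤gk
... | no  none with Fin.pigeonhole (n<1+n n) (λ k → fromℕ< (≰⇒> (λ n≤gk → none (k , n≤gk))))
...   | i , j , i<j , same = contradiction i<j (<-irrefl (g-inj (begin
  g (toℕ i)                ≡⟨ Fin.toℕ-fromℕ< _ ⟨
  toℕ (fromℕ< _)           ≡⟨ cong toℕ same ⟩
  toℕ (fromℕ< _)           ≡⟨ Fin.toℕ-fromℕ< _ ⟩
  g (toℕ j)                ∎)))
  where open ≡-Reasoning

module _ {b : List ℕ → List Bool} (B : IsBFamily b) where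
  open IsBFamily B

  private
    length-snoc : (s : List ℕ) (ℓ : ℕ) → length (s ++ [ ℓ ]) ≡ suc (length s)
    length-snoc s ℓ = trans (length-++ s) (+-comm (length s) 1)

  -- C_{s⁀ℓ} ⊆ C_s: by (4), b_{s⁀ℓ} = b_s⁀β with β an |s|-segmented word.
  C-child : ∀ s ℓ z → C b (s ++ [ ℓ ]) z → C b s z
  C-child s ℓ z (x , segx , z≡) with cond4 s ℓ
  ... | β , _ , segβ , _ , bsℓ≡ = β ⁀ x , segmented-⁀ (length s) β x segβ segx' , z≡'
    where
      segx' : SegInf (length s) x
      segx' = segmented-coarsen (length s) x (subst (λ k → SegInf k x) (length-snoc s ℓ) segx)
      z≡' : ∀ n → z n ≡ b2z ((b s ⁀ (β ⁀ x)) n)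
      z≡' n = trans (z≡ n) (cong b2z (trans (cong (λ w → (w ⁀ x) n) bsℓ≡) (⁀-++ (b s) β x n)))

  C-antitone : ∀ s t z → C b (s ++ t) z → C b s z
  C-antitone s []      z c = subst (λ u → C b u z) (++-identityʳ s) c
  C-antitone s (ℓ ∷ t) z c =
    C-child s ℓ z (C-antitone (s ++ [ ℓ ]) t z (subst (λ u → C b u z) (sym (++-assoc s [ ℓ ] t)) c))

  b-monotone : ∀ s t → ∃ λ γ → b (s ++ t) ≡ b s ++ γ
  b-monotone s [] = [] , trans (cong b (++-identityʳ s)) (sym (++-identityʳ (b s)))
  b-monotone s (ℓ ∷ t) with b-monotone (s ++ [ ℓ ]) t | cond4 s ℓ
  ... | γ , bsℓt≡ | β , _ , _ , _ , bsℓ≡ = β ++ γ , (begin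
    b (s ++ ℓ ∷ t)         ≡⟨ cong b (++-assoc s [ ℓ ] t) ⟨
    b ((s ++ [ ℓ ]) ++ t)  ≡⟨ bsℓt≡ ⟩
    b (s ++ [ ℓ ]) ++ γ    ≡⟨ cong (_++ γ) bsℓ≡ ⟩
    (b s ++ β) ++ γ        ≡⟨ ++-assoc (b s) β γ ⟩
    b s ++ (β ++ γ)        ∎)
    where open ≡-Reasoning

  -- A point of K₀ whose second coordinate begins with h(a) has first coordinate in C_a:
  -- nearby points of C_{s'} × {h₀ s'} have a ⊑ s' by h₀-prefix, C_{s'} ⊆ C_a, and C_a is closed.
  K₀-fibre : ∀ a z y → K₀ b (z , y) → y ≈[ length (h a) ] h₀ a → C b a z
  K₀-fibre a z y z,y∈K₀ y≈h₀a = Cone-closed (b a) (length a) z (λ M → from-base M (z,y∈K₀ (M + N)))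
    where
      N = length (h a)
      from-base : ∀ M → Σ Point (λ w → K₀base b w × Agree (M + N) (z , y) w) → ∃ λ z' → C b a z' × z ≈[ M ] z'
      from-base M ((z' , y') , (s' , z'∈C , y'≡) , close)
        with h₀-prefix a s' (λ i i<N → trans (sym (y≈h₀a i i<N)) (trans (proj₂ (close i (<-≤-trans i<N (m≤n+m N M)))) (y'≡ i)))
      ... | t , refl = z' , C-antitone a t z' z'∈C , λ i i<M → proj₁ (close i (<-≤-trans i<M (m≤m+n M N)))

  -- Taking for β the prefixes of x
  -- of length (2(n+k+1) + Q)·2^|s|, where |b_s| = Q·2^|s|, yields children ℓ_k, k ∈ ℕ,
  -- which are pairwise distinct because the β's have different lengths.
  module PrefixChildren (s : List ℕ) (x : ℕ → Bool) (segx : SegInf (length s) x) (n : ℕ) where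
    P : ℕ
    P = 2 ^ length s

    instance
      P≢0 : NonZero P
      P≢0 = m^n≢0 2 (length s)

    Q : ℕ
    Q = _∣_.quotient (cond2 s)

    blocks : ℕ → ℕ
    blocks k = 2 * suc (n + k) + Q

    blocks-injective : Injective _≡_ _≡_ blocks
    blocks-injective {i} {j} eq = +-cancelˡ-≡ n i j (suc-injective (*-cancelˡ-≡ _ _ 2 (+-cancelʳ-≡ Q _ _ eq)))

    n≤length : ∀ k → n ≤ blocks k * P
    n≤length k = ≤-trans (m≤m+n n k) (≤-trans (n≤1+n _) (≤-trans (m≤m+n _ _) (≤-trans (m≤m+n _ Q) (m≤m*n _ P))))

    β : ℕ → List Bool
    β k = applyUpTo x (blocks k * P)

    |β|≡ : ∀ k → length (β k) ≡ blocks k * P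
    |β|≡ k = length-applyUpTo x (blocks k * P)

    -- |b_s| + |β_k| = (Q + n + k + 1)·2^(|s|+1).
    admissible : ∀ k → 2 ^ suc (length s) ∣ length (b s) + length (β k)
    admissible k = divides (Q + suc (n + k))
      (trans (cong₂ _+_ (_∣_.equality (cond2 s)) (|β|≡ k)) (regroup Q (suc (n + k)) P))
      where
        regroup : ∀ Q a P → Q * P + (2 * a + Q) * P ≡ (Q + a) * (2 * P)
        regroup = solve-∀

    child-spec : ∀ k → Σ ℕ λ ℓ → (b (s ++ [ ℓ ]) ≡ b s ++ β k) × (∀ ℓ' → b (s ++ [ ℓ' ]) ≡ b s ++ β k → ℓ' ≡ ℓ)
    child-spec k = cond3 s (β k) (applyUpTo-nonempty x (blocks k * P) {{m*n≢0 (blocks k) P}})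
                         (segmented-prefix (length s) x (blocks k) segx) (admissible k)

    child : ℕ → ℕ
    child k = proj₁ (child-spec k)

    child-eq : ∀ k → b (s ++ [ child k ]) ≡ b s ++ β k
    child-eq k = proj₁ (proj₂ (child-spec k))

    child-injective : Injective _≡_ _≡_ child
    child-injective {i} {j} eq = blocks-injective (*-cancelʳ-≡ _ _ P (begin
      blocks i * P     ≡⟨ |β|≡ i ⟨
      length (β i)     ≡⟨ cong length (++-cancelˡ (b s) (β i) (β j) same-child) ⟩
      length (β j)     ≡⟨ |β|≡ j ⟩
      blocks j * P     ∎))
      where
        open ≡-Reasoning
        same-child : b s ++ β i ≡ b s ++ β j
        same-child = trans (sym (child-eq i)) (trans (cong (λ ℓ → b (s ++ [ ℓ ])) eq) (child-eq j))

  long-extension : ∀ s x → SegInf (length s) x → ∀ n →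
                   ∃₂ λ ℓ L → n ≤ ℓ × n ≤ L × b (s ++ [ ℓ ]) ≡ b s ++ applyUpTo x L
  long-extension s x segx n =
    let (k , n≤child) = injective⇒unbounded child child-injective n
    in child k , blocks k * P , n≤child , n≤length k , child-eq k
    where open PrefixChildren s x segx n

  canonical-near : ∀ s x ℓ L n → n ≤ ℓ → n ≤ L → b (s ++ [ ℓ ]) ≡ b s ++ applyUpTo x L →
                   ∀ a → (s ++ [ ℓ ]) ⊑ a → Agree n ((λ i → b2z ((b s ⁀ x) i)) , h₀ s) (canonical b a)
  canonical-near s x ℓ L n n≤ℓ n≤L bsℓ≡ a (t , refl) i i<n = cong b2z z-close , y-close
    where
      open ≡-Reasoning
      γ : List Bool
      γ = proj₁ (b-monotone (s ++ [ ℓ ]) t)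
      ba≡ : b a ≡ (b s ++ applyUpTo x L) ++ γ
      ba≡ = trans (proj₂ (b-monotone (s ++ [ ℓ ]) t)) (cong (_++ γ) bsℓ≡)
      x≈prefix : x ≈[ L ] (applyUpTo x L ⁀ (γ ⁀ (λ _ → false)))
      x≈prefix j j<L = sym (applyUpTo-⁀ x L _ j j<L)
      z-close : (b s ⁀ x) i ≡ (b a ⁀ (λ _ → false)) i
      z-close = begin
        (b s ⁀ x) i                                             ≡⟨ ⁀-≈ (b s) x≈prefix i (<-≤-trans i<n (≤-trans n≤L (m≤n+m L _))) ⟩
        (b s ⁀ (applyUpTo x L ⁀ (γ ⁀ (λ _ → false)))) i          ≡⟨ ⁀-++ (b s) (applyUpTo x L) _ i ⟨
        ((b s ++ applyUpTo x L) ⁀ (γ ⁀ (λ _ → false))) i         ≡⟨ ⁀-++ (b s ++ applyUpTo x L) γ _ i ⟨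
        (((b s ++ applyUpTo x L) ++ γ) ⁀ (λ _ → false)) i        ≡⟨ cong (λ w → (w ⁀ (λ _ → false)) i) ba≡ ⟨
        (b a ⁀ (λ _ → false)) i                                  ∎
      y-close : h₀ s i ≡ h₀ a i
      y-close = trans (h₀-extension s ℓ t i (<-≤-trans i<n (≤-trans n≤ℓ (m≤n+m ℓ _))))
                      (cong (λ u → h₀ u i) (sym (++-assoc s [ ℓ ] t)))

lemma4p11 : (b : List ℕ → List Bool) → IsBFamily b →
    (X : (ℕ → ℤ) → Set) →
    Cofinal (λ s' → ∀ z → C b s' z → ¬ X z) →
    NowhereDenseIn (K₀ b) (f₀⁻¹ b X)
lemma4p11 b B X cofinal (pz , py) (p∈K₀ , n , interior) =
  let
      ((z₀ , y₀) , (s , (x , segx , z₀≡) , y₀≡) , p≈base) = p∈K₀ n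
      -- a child s⁀ℓ, ℓ ≥ n, with b_{s⁀ℓ} extending b_s along x, and a ⊒ s⁀ℓ avoiding X
      (ℓ , L , n≤ℓ , n≤L , bsℓ≡) = long-extension B s x segx n
      (a , sℓ⊑a , C-a∩X≡∅) = cofinal (s ++ [ ℓ ])
      p≈q = Agree-trans p≈base (Agree-trans (λ i _ → z₀≡ i , y₀≡ i)
                                            (canonical-near B s x ℓ L n n≤ℓ n≤L bsℓ≡ a sℓ⊑a))
      (_ , q∈cl) = interior (canonical b a) (canonical∈K₀ b a) p≈q
      -- so a point r ∈ K₀ with r_z ∈ X begins with h(a); but then r_z ∈ C_a
      ((rz , ry) , (r∈K₀ , rz∈X) , q≈r) = q∈cl (length (h a))
  in C-a∩X≡∅ rz (K₀-fibre B a rz ry r∈K₀ (λ i i<N → sym (proj₂ (q≈r i i<N)))) rz∈X
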